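{- Let $m\ge1$ and let $\{a_n\}_{n\ge0}$ be the $m$-gonal sequence. If $k\ge0$ and $1\le r\le m$, then $a_{mk+r}=r\cdot a_{mk+1}$.
   Context: Bins of an increasing sequence $\{a_n\}_{n\ge0}$: $b_0=[a_0]$, $b_k=[a_{m(k-1)+1},\dots,a_{mk}]$ for $k\ge1$. A legal $m$-gonal decomposition of $z$ is $z=a_{\ell_t}+\cdots+a_{\ell_1}$ with $\ell_1<\cdots<\ell_t$ and no two summands in the same bin. The $m$-gonal sequence: each $a_i$ ($i\ge0$) is the smallest positive integer with no legal $m$-gonal decomposition using only $a_0,\dots,a_{i-1}$. -}

module Defs where

open import Data.Nat using (ℕ; zero; suc; _+_; _*_; _∸_; _<_; NonZero)
open import Data.Nat.DivMod using (_/_)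
open import Data.List using (List; map)
open import Data.Nat.ListAction using (sum)
open import Data.List.Relation.Unary.All using (All)
open import Data.List.Relation.Unary.AllPairs using (AllPairs)
open import Data.Product using (Σ; _×_)
open import Relation.Binary.PropositionalEquality using (_≡_; _≢_)
open import Relation.Nullary using (¬_)

-- Bin index of position j: b_0 = [a_0], b_k = [a_{m(k-1)+1}, …, a_{mk}] (k ≥ 1).
-- So index 0 is in bin 0 and index j+1 is in bin (j / m) + 1.
bin : (m : ℕ) → .{{NonZero m}} → ℕ → ℕ
bin m zero    = zero
bin m (suc j) = suc (j / m)

LegalDecomp : (m : ℕ) → .{{NonZero m}} → (ℕ → ℕ) → ℕ → ℕ → Set
LegalDecomp m a i z =
  Σ (List ℕ) λ ls →
    AllPairs _<_ ls ×
    All (_< i) ls ×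
    AllPairs (λ x y → bin m x ≢ bin m y) ls ×
    sum (map a ls) ≡ z

IsMGonal : (m : ℕ) → .{{NonZero m}} → (ℕ → ℕ) → Set
IsMGonal m a = (i : ℕ) →
  (0 < a i) ×
  ¬ LegalDecomp m a i (a i) ×
  ((z : ℕ) → 0 < z → z < a i → LegalDecomp m a i z)

module Submission where

-- The outer invariant, `BlockBound k`, says that
-- every number with a legal decomposition into terms a_0, …, a_{mk} (bins 0, …, k)
-- is smaller than c = a_{mk+1}.  Given it, we show by induction on n ≤ m that
-- a_{mk+1+j} = (j+1)c for all j < n.  For the step to a_{mk+1+n}:
--   * a legal decomposition with indices below mk+1+n has at most one term in
--     bin k+1 (`split-at-block`), so its sum is below c + n·c (`block-bound`);
--   * every z < (n+1)c is z = r + q·c with r < c and q ≤ n; r is decomposable in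
--     bins 0, …, k (it lies below a_{mk+1}), and for q ≥ 1 we add the term
--     a_{mk+q} = q·c from bin k+1 (`block-representable`).
-- Hence (n+1)c is the least undecomposable number, i.e. a_{mk+1+n} (`mgonal-char`).
-- Taking n = m yields a_{m(k+1)+1} = (m+1)c, which together with `block-bound`
-- gives `BlockBound (k+1)`; the base case `BlockBound 0` only needs a_0 < a_1.

open import Defs
open import Data.Nat using (ℕ; zero; suc; _+_; _*_; _≤_; _<_; _∸_; NonZero; >-nonZero;
  z≤n; s≤s; s<s⁻¹; _/_; _%_; _<?_)
open import Data.Nat.Properties
open import Data.Nat.DivMod using (m<n⇒m/n≡0; m*n/n≡m; +-distrib-/-∣ˡ; m≡m%n+[m/n]*n; m%n<n; m<n*o⇒m/o<n)
open import Data.Nat.Divisibility using (m∣m*n)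
open import Data.Nat.ListAction using (sum)
open import Data.Nat.ListAction.Properties using (sum-++)
open import Data.List using (List; []; _∷_; _++_; [_]; map)
open import Data.List.Properties using (map-++)
open import Data.List.Relation.Unary.All as All using (All; []; _∷_)
import Data.List.Relation.Unary.All.Properties as All
open import Data.List.Relation.Unary.AllPairs as AllPairs using (AllPairs; []; _∷_)
import Data.List.Relation.Unary.AllPairs.Properties as AllPairs
open import Data.Product using (Σ; _×_; _,_; proj₁; proj₂)
open import Data.Sum using (inj₁; inj₂)
open import Relation.Nullary using (¬_; yes; no; contradiction)
open import Relation.Binary using (tri<; tri≈; tri>)
open import Relation.Binary.PropositionalEquality hiding ([_])

module Bins (m : ℕ) .{{_ : NonZero m}} where

  bin-below : ∀ k x → x < m * k + 1 → bin m x ≤ k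
  bin-below k zero    _  = z≤n
  bin-below k (suc x) 1+x<start = m<n*o⇒m/o<n x<km
    where
      x<km : x < k * m
      x<km = subst (x <_) (*-comm m k) (m<1+n⇒m≤n (subst (suc x <_) (+-comm (m * k) 1) 1+x<start))

  bin-block : ∀ k j → j < m → bin m (m * k + suc j) ≡ suc k
  bin-block k j j<m = begin
    bin m (m * k + suc j)    ≡⟨ cong (bin m) (+-suc (m * k) j) ⟩
    suc ((m * k + j) / m)    ≡⟨ cong suc (+-distrib-/-∣ˡ j (m∣m*n k)) ⟩
    suc (m * k / m + j / m)  ≡⟨ cong suc (cong₂ _+_ (trans (cong (_/ m) (*-comm m k)) (m*n/n≡m k m)) (m<n⇒m/n≡0 j<m)) ⟩
    suc (k + 0)              ≡⟨ cong suc (+-identityʳ k) ⟩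
    suc k                    ∎
    where open ≡-Reasoning

module MGonal (m : ℕ) .{{_ : NonZero m}} (a : ℕ → ℕ) (mgonal : IsMGonal m a) where
  open Bins m

  LD : ℕ → ℕ → Set
  LD = LegalDecomp m a

  DistinctBins : ℕ → ℕ → Set
  DistinctBins x y = bin m x ≢ bin m y

  weaken : ∀ {i j z} → i ≤ j → LD i z → LD j z
  weaken i≤j (ls , sorted , bounded , bins , total) =
    ls , sorted , All.map (λ x<i → <-≤-trans x<i i≤j) bounded , bins , total

  decomposable-below : ∀ i z → z < a i → LD i z
  decomposable-below i zero    _  = [] , [] , [] , [] , refl
  decomposable-below i (suc z) lt = proj₂ (proj₂ (mgonal i)) (suc z) (s≤s z≤n) lt

  mgonal-char : ∀ i x → 0 < x → ¬ LD i x → (∀ z → 0 < z → z < x → LD i z) → a i ≡ x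
  mgonal-char i x x>0 undecomposable below with <-cmp (a i) x
  ... | tri< lt _ _ = contradiction (below (a i) (proj₁ (mgonal i)) lt) (proj₁ (proj₂ (mgonal i)))
  ... | tri≈ _ eq _ = eq
  ... | tri> _ _ gt = contradiction (proj₂ (proj₂ (mgonal i)) x x>0 gt) undecomposable

  -- The sequence is strictly increasing: a_{i+1} ≠ a_i since a_i = a_i is a legal
  -- decomposition using a_0, …, a_i, and a_{i+1} < a_i would make a_{i+1}
  -- decomposable with a_0, …, a_{i-1}.
  mgonal-increasing : ∀ i → a i < a (suc i)
  mgonal-increasing i = ≤∧≢⇒< (≮⇒≥ not-smaller) not-equal
    where
      singleton : LD (suc i) (a i)
      singleton = [ i ] , [] ∷ [] , n<1+n i ∷ [] , [] ∷ [] , +-identityʳ (a i)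
      not-equal : a i ≢ a (suc i)
      not-equal eq = proj₁ (proj₂ (mgonal (suc i))) (subst (LD (suc i)) eq singleton)
      not-smaller : ¬ a (suc i) < a i
      not-smaller lt = proj₁ (proj₂ (mgonal (suc i)))
        (weaken (n≤1+n i) (proj₂ (proj₂ (mgonal i)) (a (suc i)) (proj₁ (mgonal (suc i))) lt))

  sum-snoc : ∀ ls y → sum (map a (ls ++ [ y ])) ≡ sum (map a ls) + a y
  sum-snoc ls y = begin
    sum (map a (ls ++ [ y ]))      ≡⟨ cong sum (map-++ a ls [ y ]) ⟩
    sum (map a ls ++ [ a y ])      ≡⟨ sum-++ (map a ls) [ a y ] ⟩
    sum (map a ls) + (a y + 0)     ≡⟨ cong (sum (map a ls) +_) (+-identityʳ (a y)) ⟩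
    sum (map a ls) + a y           ∎
    where open ≡-Reasoning

  BlockBound : ℕ → Set
  BlockBound k = ∀ z → LD (m * k + 1) z → z < a (m * k + 1)

  -- Base case: only a_0 is available, and a_0 < a_1.
  block-bound-zero : BlockBound 0
  block-bound-zero z (ls , sorted , bounded , _ , total) rewrite *-zeroʳ m =
    subst (_< a 1) total (only-a₀ ls sorted bounded)
    where
      only-a₀ : ∀ ls → AllPairs _<_ ls → All (_< 1) ls → sum (map a ls) < a 1
      only-a₀ []                   _                _              = proj₁ (mgonal 1)
      only-a₀ (zero ∷ [])          _                _              = subst (_< a 1) (sym (+-identityʳ (a 0))) (mgonal-increasing 0)
      only-a₀ (zero ∷ .zero ∷ _)   ((() ∷ _) ∷ _)   (_ ∷ s≤s z≤n ∷ _)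
      only-a₀ (suc _ ∷ _)          _                (s≤s () ∷ _)

  module Block (k : ℕ) where

    c : ℕ
    c = a (m * k + 1)

    Linear : ℕ → Set
    Linear n = ∀ j → j < n → a (m * k + suc j) ≡ suc j * c

    block-position : ∀ {x} → m * k + 1 ≤ x → x < m * k + suc m →
                     Σ ℕ λ j → j < m × m * k + suc j ≡ x
    block-position {x} start≤x x<end = j , j<m , position
      where
        j : ℕ
        j = x ∸ (m * k + 1)
        position : m * k + suc j ≡ x
        position = trans (sym (+-assoc (m * k) 1 j)) (m+[n∸m]≡n start≤x)
        j<m : j < m
        j<m = s<s⁻¹ (+-cancelˡ-< (m * k) (suc j) (suc m) (subst (_< m * k + suc m) (sym position) x<end))

    data BlockSplit : List ℕ → Set where
      all-below    : ∀ {ls} → AllPairs _<_ ls → All (_< m * k + 1) ls → AllPairs DistinctBins ls →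
                     BlockSplit ls
      one-in-block : ∀ {init} j → j < m →
                     AllPairs _<_ init → All (_< m * k + 1) init → AllPairs DistinctBins init →
                     BlockSplit (init ++ [ m * k + suc j ])

    -- Two indices of bin k+1 would share a bin, so any second one is a contradiction.
    split-at-block : ∀ ls → AllPairs _<_ ls → AllPairs DistinctBins ls → All (_< m * k + suc m) ls →
                     BlockSplit ls
    split-at-block [] _ _ _ = all-below [] [] []
    split-at-block (x ∷ xs) (x<xs ∷ sorted) (x#xs ∷ bins) (_ ∷ bounded) with x <? m * k + 1
    ... | yes x-below with split-at-block xs sorted bins bounded
    ...   | all-below _ below _ = all-below (x<xs ∷ sorted) (x-below ∷ below) (x#xs ∷ bins)
    ...   | one-in-block {init} j j<m s below b =
              one-in-block j j<m (All.++⁻ˡ init x<xs ∷ s) (x-below ∷ below) (All.++⁻ˡ init x#xs ∷ b)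
    split-at-block (x ∷ []) _ _ (x<end ∷ _) | no x-in-block
      with j , j<m , refl ← block-position (≮⇒≥ x-in-block) x<end = one-in-block j j<m [] [] []
    split-at-block (x ∷ y ∷ _) ((x<y ∷ _) ∷ _) ((x#y ∷ _) ∷ _) (x<end ∷ y<end ∷ _) | no x-in-block =
      contradiction (trans (in-block x start≤x x<end) (sym (in-block y (≤-trans start≤x (<⇒≤ x<y)) y<end))) x#y
      where
        start≤x : m * k + 1 ≤ x
        start≤x = ≮⇒≥ x-in-block
        in-block : ∀ z → m * k + 1 ≤ z → z < m * k + suc m → bin m z ≡ suc k
        in-block z start≤z z<end with j , j<m , refl ← block-position start≤z z<end = bin-block k j j<m

    append-block : ∀ {i r} j → j < m → m * k + suc j < i → LD (m * k + 1) r →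
                   LD i (r + a (m * k + suc j))
    append-block j j<m y<i (ls , sorted , bounded , bins , total) =
      ls ++ [ y ] ,
      AllPairs.++⁺ sorted ([] ∷ []) (All.map (λ x<start → <-≤-trans x<start start≤y ∷ []) bounded) ,
      All.++⁺ (All.map (λ x<start → <-trans (<-≤-trans x<start start≤y) y<i) bounded) (y<i ∷ []) ,
      AllPairs.++⁺ bins ([] ∷ []) (All.map (λ {x} x<start → other-bin x x<start ∷ []) bounded) ,
      trans (sum-snoc ls y) (cong (_+ a y) total)
      where
        y : ℕ
        y = m * k + suc j
        start≤y : m * k + 1 ≤ y
        start≤y = +-monoʳ-≤ (m * k) (s≤s z≤n)
        other-bin : ∀ x → x < m * k + 1 → DistinctBins x y
        other-bin x x<start same = 1+n≰n (subst (_≤ k) (trans same (bin-block k j j<m)) (bin-below k x x<start))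

    block-bound : BlockBound k → ∀ {n} → n ≤ m → Linear n →
                  ∀ z → LD (m * k + suc n) z → z < suc n * c
    block-bound below-c {n} n≤m multiples z (ls , sorted , bounded , bins , total) =
      subst (_< suc n * c) total (by-split (split-at-block ls sorted bins (All.map widen bounded)) bounded)
      where
        widen : ∀ {x} → x < m * k + suc n → x < m * k + suc m
        widen x<bound = <-≤-trans x<bound (+-monoʳ-≤ (m * k) (s≤s n≤m))
        by-split : ∀ {ls} → BlockSplit ls → All (_< m * k + suc n) ls → sum (map a ls) < suc n * c
        by-split (all-below s below b) _ = <-≤-trans (below-c _ (_ , s , below , b , refl)) (m≤m+n c (n * c))
        by-split (one-in-block {init} j _ s below b) bounded = begin-strict
          sum (map a (init ++ [ y ])) ≡⟨ sum-snoc init y ⟩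
          sum (map a init) + a y      <⟨ +-monoˡ-< (a y) (below-c _ (init , s , below , b , refl)) ⟩
          c + a y                     ≡⟨ cong (c +_) (multiples j j<n) ⟩
          c + suc j * c               ≤⟨ +-monoʳ-≤ c (*-monoˡ-≤ c j<n) ⟩
          suc n * c                   ∎
          where
            open ≤-Reasoning
            y : ℕ
            y = m * k + suc j
            y<bound : y < m * k + suc n
            y<bound with y<b ∷ [] ← All.++⁻ʳ init bounded = y<b
            j<n : j < n
            j<n = s<s⁻¹ (+-cancelˡ-< (m * k) (suc j) (suc n) y<bound)

    -- Representability: every z < (n+1)c is r + qc with r < c, q ≤ n, which is
    -- decomposed by a decomposition of r in bins 0, …, k plus the term a_{mk+q} = qc.
    block-representable : ∀ {n} → n ≤ m → Linear n → ∀ z → z < suc n * c → LD (m * k + suc n) z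
    block-representable {n} n≤m multiples z z<bound =
      subst (LD (m * k + suc n)) (sym (m≡m%n+[m/n]*n z c))
        (remainder-plus-multiple (z / c) (z % c) (m<n*o⇒m/o<n {n = suc n} {o = c} z<bound) (m%n<n z c))
      where
        instance
          c-nonZero : NonZero c
          c-nonZero = >-nonZero (proj₁ (mgonal (m * k + 1)))
        remainder-plus-multiple : ∀ q r → q < suc n → r < c → LD (m * k + suc n) (r + q * c)
        remainder-plus-multiple zero r _ r<c =
          subst (LD (m * k + suc n)) (sym (+-identityʳ r))
            (weaken (+-monoʳ-≤ (m * k) (s≤s z≤n)) (decomposable-below (m * k + 1) r r<c))
        remainder-plus-multiple (suc j) r q<bound r<c =
          subst (LD (m * k + suc n)) (cong (r +_) (multiples j j<n))
            (append-block j (<-≤-trans j<n n≤m) (+-monoʳ-< (m * k) (s≤s j<n)) (decomposable-below (m * k + 1) r r<c))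
          where
            j<n : j < n
            j<n = s<s⁻¹ q<bound

    block-step : BlockBound k → ∀ {n} → n ≤ m → Linear n → a (m * k + suc n) ≡ suc n * c
    block-step below-c {n} n≤m multiples = mgonal-char _ _ positive
      (λ decomposable → <-irrefl refl (block-bound below-c n≤m multiples _ decomposable))
      (λ z _ z<bound → block-representable n≤m multiples z z<bound)
      where
        positive : 0 < suc n * c
        positive = <-≤-trans (proj₁ (mgonal (m * k + 1))) (m≤m+n c (n * c))

    linear : BlockBound k → ∀ n → n ≤ m → Linear n
    linear _       zero    _    _ ()
    linear below-c (suc n) n<m j j<1+n with m<1+n⇒m<n∨m≡n j<1+n
    ... | inj₁ j<n  = linear below-c n (<⇒≤ n<m) j j<n
    ... | inj₂ refl = block-step below-c (<⇒≤ n<m) (linear below-c n (<⇒≤ n<m))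

  -- The outer induction: a_{m(k+1)+1} = a_{mk+m+1} = (m+1)c bounds bins 0, …, k+1.
  block-bound-all : ∀ k → BlockBound k
  block-bound-all zero    = block-bound-zero
  block-bound-all (suc k) z decomposable = begin-strict
    z                   <⟨ block-bound below-c ≤-refl full z (subst (λ i → LD i z) next-start decomposable) ⟩
    suc m * c           ≡⟨ sym (block-step below-c ≤-refl full) ⟩
    a (m * k + suc m)   ≡⟨ cong a (sym next-start) ⟩
    a (m * suc k + 1)   ∎
    where
      open ≤-Reasoning
      open Block k
      below-c : BlockBound k
      below-c = block-bound-all k
      full : Linear m
      full = linear below-c m ≤-refl
      next-start : m * suc k + 1 ≡ m * k + suc m
      next-start = trans (cong (_+ 1) (trans (*-suc m k) (+-comm m (m * k))))
                         (trans (+-assoc (m * k) m 1) (cong (m * k +_) (+-comm m 1)))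

lemma2p3 : (m : ℕ) → .{{_ : NonZero m}} → (a : ℕ → ℕ) → IsMGonal m a →
    (k r : ℕ) → 1 ≤ r → r ≤ m → a (m * k + r) ≡ r * a (m * k + 1)
lemma2p3 m a mgonal k zero    ()
lemma2p3 m a mgonal k (suc j) _ j<m = Block.linear k (block-bound-all k) m ≤-refl j j<m
  where open MGonal m a mgonal
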